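{- Let $J$ be a set of unit jobs admitting a feasible schedule on $T$, and let $\mathcal M(J)=(T,\mathcal I)$ be its scheduling matroid. Let $S\subseteq T$ and let $F\in\mathcal I$ be a maximum-size independent set contained in $S$. For each slot $x\in F$ create a rigid unit job with release time and deadline equal to $x$, and let $J'$ be the set of these jobs; let $\mathcal M(J\cup J')=(T,\mathcal I')$. Let $H\subseteq T$ and let $B\in\mathcal I'$ be a maximum-size independent set of $\mathcal M(J\cup J')$ contained in $H$. Then $F\cup B\in\mathcal I$ and $F\cup B$ is a maximum-size independent set of $\mathcal M(J)$ contained in $S\cup H$.
   Context: Scheduling matroid: for a set $J$ of unit jobs (job $j$ must be processed in exactly one slot of its interval $\{r_j,\dots,d_j\}$, each slot holding at most one job), $\mathcal M(J)=(T,\mathcal I)$ has ground set the slot set $T$, and $I\subseteq T$ is independent iff all jobs of $J$ can be feasibly scheduled using only slots in $T\setminus I$. -}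

module Defs where

open import Data.Nat using (ℕ)
open import Data.Fin using (Fin) renaming (_≤_ to _≤ᶠ_)
open import Data.Fin.Subset using (Subset; _∈_; _∉_; _⊆_; ∣_∣)
open import Data.Fin.Subset.Properties using (_∈?_)
open import Data.List using (List; length; lookup; map; filter; _++_)
open import Data.List.Base using (allFin)
open import Data.Product using (Σ; _×_; _,_; proj₁; proj₂)
open import Function.Definitions using (Injective)
open import Relation.Binary.PropositionalEquality using (_≡_)

-- Time slots are T = Fin n (any finite totally ordered slot set, relabelled).
-- A unit job is a pair (release r , deadline d); it may be processed in any
-- slot t with r ≤ t ≤ d.
Job : ℕ → Set
Job n = Fin n × Fin n

release deadline : ∀ {n} → Job n → Fin n
release = proj₁
deadline = proj₂

-- A set of jobs is a list (jobs are distinct entities, identical intervals allowed).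
SchedulableAvoiding : ∀ {n} → List (Job n) → Subset n → Set
SchedulableAvoiding {n} J I =
  Σ (Fin (length J) → Fin n) λ σ →
    Injective _≡_ _≡_ σ ×
    (∀ j → release (lookup J j) ≤ᶠ σ j × σ j ≤ᶠ deadline (lookup J j) × σ j ∉ I)

Independent : ∀ {n} → List (Job n) → Subset n → Set
Independent J I = SchedulableAvoiding J I

Feasible : ∀ {n} → List (Job n) → Set
Feasible {n} J = SchedulableAvoiding J Data.Fin.Subset.⊥

MaxIndepIn : ∀ {n} → List (Job n) → Subset n → Subset n → Set
MaxIndepIn {n} J S F =
  F ⊆ S × Independent J F ×
  (∀ (G : Subset n) → G ⊆ S → Independent J G → ∣ G ∣ Data.Nat.≤ ∣ F ∣)

elements : ∀ {n} → Subset n → List (Fin n)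
elements {n} F = filter (_∈? F) (allFin n)

rigidJobs : ∀ {n} → Subset n → List (Job n)
rigidJobs F = map (λ x → (x , x)) (elements F)

{-# OPTIONS --safe #-}
-- The scheduling matroid satisfies the augmentation axiom, by induction on the
-- jobs: if the first job sits at a in a schedule avoiding X and at b in one
-- avoiding Y, augment ({a} ∪ X, {b} ∪ Y) for the remaining jobs; a new slot from
-- Y keeps the first job at a, and if the new slot is b itself, augment once more
-- from {b} ∪ X and move the first job to b.
-- Adding the rigid jobs J' contracts F: X is independent for J ∪ J' iff X is
-- disjoint from F and F ∪ X is independent for J.  Since in a matroid a set that
-- cannot be extended inside S ∪ H is maximum there, it suffices that no slot g
-- extends F ∪ B: if g ∈ S it would extend F, and if g ∈ H it would extend B in
-- the contraction.
module Submission where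

open import Defs
open import Data.Nat using (ℕ; suc; _<_; _≤_; s≤s)
open import Data.Nat.Properties using (1+n≰n; ≮⇒≥; <⇒≱)
open import Data.List using (List; []; _∷_; _++_; map; allFin; length; lookup)
open import Data.List.Membership.Propositional using () renaming (_∈_ to _∈ₗ_)
open import Data.List.Membership.Propositional.Properties
  using (∈-filter⁺; ∈-filter⁻; ∈-allFin)
open import Data.List.Relation.Unary.All using () renaming (lookup to lookupᴬ)
open import Data.List.Relation.Unary.Any using (here; there)
open import Data.List.Relation.Unary.Unique.Propositional using (Unique; []; _∷_)
open import Data.List.Relation.Unary.Unique.Propositional.Properties
  using (filter⁺; allFin⁺)
open import Data.Fin using (Fin; zero; suc) renaming (_≤_ to _≤ᶠ_)
open import Data.Fin.Properties using (¬∀⟶∃¬; suc-injective; 0≢1+n)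
  renaming (≤-antisym to ≤ᶠ-antisym; ≤-refl to ≤ᶠ-refl)
open import Data.Fin.Subset
  using (Subset; _∪_; _∈_; _∉_; _⊆_; _⊈_; ∣_∣; ⁅_⁆; inside; outside)
open import Data.Fin.Subset.Properties
  using (_∈?_; x∈p∪q⁻; p⊆p∪q; q⊆p∪q; x∈⁅x⁆; x∈⁅y⁆⇒x≡y; x≢y⇒x∉⁅y⁆; x∉⁅y⁆⇒x≢y;
         p⊆q⇒∣p∣≤∣q∣; ⊆-refl; ⊆-reflexive; ∪-assoc; ∪-comm; ∪-identityˡ)
open import Data.Vec.Base using (_∷_; here; there)
open import Data.Product using (∃; _×_; _,_; proj₁; proj₂)
open import Data.Sum using (inj₁; inj₂; [_,_]′)
open import Function using (_∘_; id)
open import Function.Definitions using (Injective)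
open import Relation.Nullary using (¬_; yes; no; contradiction)
open import Relation.Nullary.Decidable using (_→-dec_)
open import Relation.Binary.PropositionalEquality
  using (_≡_; _≢_; refl; sym; cong; subst; subst₂; module ≡-Reasoning)

private
  variable
    n : ℕ
    p q r p′ q′ X Y S : Subset n
    x y : Fin n

∪-lub : p ⊆ r → q ⊆ r → p ∪ q ⊆ r
∪-lub {p = p} {q = q} p⊆r q⊆r x∈p∪q = [ p⊆r , q⊆r ]′ (x∈p∪q⁻ p q x∈p∪q)

∪-mono-⊆ : p ⊆ p′ → q ⊆ q′ → p ∪ q ⊆ p′ ∪ q′
∪-mono-⊆ {p′ = p′} {q′ = q′} p⊆p′ q⊆q′ =
  ∪-lub (λ x∈p → p⊆p∪q q′ (p⊆p′ x∈p)) (λ x∈q → q⊆p∪q p′ q′ (q⊆q′ x∈q))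

∪-monoʳ-⊆ : q ⊆ r → p ∪ q ⊆ p ∪ r
∪-monoʳ-⊆ = ∪-mono-⊆ ⊆-refl

p∪q∪r≡q∪p∪r : ∀ (p q r : Subset n) → p ∪ q ∪ r ≡ q ∪ p ∪ r
p∪q∪r≡q∪p∪r p q r = begin
  p ∪ (q ∪ r)  ≡⟨ sym (∪-assoc p q r) ⟩
  (p ∪ q) ∪ r  ≡⟨ cong (_∪ r) (∪-comm p q) ⟩
  (q ∪ p) ∪ r  ≡⟨ ∪-assoc q p r ⟩
  q ∪ (p ∪ r)  ∎
  where open ≡-Reasoning

x∈p⇒⁅x⁆⊆p : x ∈ p → ⁅ x ⁆ ⊆ p
x∈p⇒⁅x⁆⊆p {x = x} {p = p} x∈p y∈⁅x⁆ = subst (_∈ p) (sym (x∈⁅y⁆⇒x≡y x y∈⁅x⁆)) x∈p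

x∉⁅y⁆⇒y∉⁅x⁆ : x ∉ ⁅ y ⁆ → y ∉ ⁅ x ⁆
x∉⁅y⁆⇒y∉⁅x⁆ x∉⁅y⁆ = x≢y⇒x∉⁅y⁆ (x∉⁅y⁆⇒x≢y x∉⁅y⁆ ∘ sym)

x∉p∪q⁺ : x ∉ p → x ∉ q → x ∉ p ∪ q
x∉p∪q⁺ {p = p} {q = q} x∉p x∉q x∈p∪q = [ x∉p , x∉q ]′ (x∈p∪q⁻ p q x∈p∪q)

x∉p∪q⁻ : ∀ (p q : Subset n) → x ∉ p ∪ q → x ∉ p × x ∉ q
x∉p∪q⁻ p q x∉p∪q = (λ x∈p → x∉p∪q (p⊆p∪q q x∈p)) , (λ x∈q → x∉p∪q (q⊆p∪q p q x∈q))

x∈p∪q∧x∉p⇒x∈q : ∀ (p q : Subset n) → x ∈ p ∪ q → x ∉ p → x ∈ q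
x∈p∪q∧x∉p⇒x∈q p q x∈p∪q x∉p = [ (λ x∈p → contradiction x∈p x∉p) , id ]′ (x∈p∪q⁻ p q x∈p∪q)

Disjoint : Subset n → Subset n → Set
Disjoint p q = ∀ {x} → x ∈ p → x ∉ q

Disjoint-⁅x⁆∪ : x ∉ p → Disjoint p q → Disjoint p (⁅ x ⁆ ∪ q)
Disjoint-⁅x⁆∪ {p = p} x∉p p#q y∈p = x∉p∪q⁺ (x≢y⇒x∉⁅y⁆ λ { refl → x∉p y∈p }) (p#q y∈p)

x∉p⇒∣⁅x⁆∪p∣≡1+∣p∣ : x ∉ p → ∣ ⁅ x ⁆ ∪ p ∣ ≡ suc ∣ p ∣
x∉p⇒∣⁅x⁆∪p∣≡1+∣p∣ {x = zero}  {p = outside ∷ p} _   = cong (suc ∘ ∣_∣) (∪-identityˡ p)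
x∉p⇒∣⁅x⁆∪p∣≡1+∣p∣ {x = zero}  {p = inside ∷ p}  x∉p = contradiction here x∉p
x∉p⇒∣⁅x⁆∪p∣≡1+∣p∣ {x = suc x} {p = outside ∷ p} x∉p = x∉p⇒∣⁅x⁆∪p∣≡1+∣p∣ (x∉p ∘ there)
x∉p⇒∣⁅x⁆∪p∣≡1+∣p∣ {x = suc x} {p = inside ∷ p}  x∉p =
  cong suc (x∉p⇒∣⁅x⁆∪p∣≡1+∣p∣ (x∉p ∘ there))

∣⁅x⁆∪p∣<∣⁅y⁆∪q∣ : x ∉ p → y ∉ q → ∣ p ∣ < ∣ q ∣ → ∣ ⁅ x ⁆ ∪ p ∣ < ∣ ⁅ y ⁆ ∪ q ∣
∣⁅x⁆∪p∣<∣⁅y⁆∪q∣ x∉p y∉q ∣p∣<∣q∣ =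
  subst₂ _<_ (sym (x∉p⇒∣⁅x⁆∪p∣≡1+∣p∣ x∉p)) (sym (x∉p⇒∣⁅x⁆∪p∣≡1+∣p∣ y∉q)) (s≤s ∣p∣<∣q∣)

p⊈q⇒∃[x∈p∖q] : p ⊈ q → ∃ λ x → x ∈ p × x ∉ q
p⊈q⇒∃[x∈p∖q] {n} {p} {q} p⊈q
  with x , x∈p↛x∈q ← ¬∀⟶∃¬ n (λ x → x ∈ p → x ∈ q) (λ x → x ∈? p →-dec x ∈? q)
                                (λ p⊆q → p⊈q (p⊆q _))
  with x ∈? p
... | yes x∈p = x , x∈p , λ x∈q → x∈p↛x∈q (λ _ → x∈q)
... | no  x∉p = contradiction (λ x∈p → contradiction x∈p x∉p) x∈p↛x∈q

∣p∣<∣q∣⇒∃[x∈q∖p] : ∣ p ∣ < ∣ q ∣ → ∃ λ x → x ∈ q × x ∉ p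
∣p∣<∣q∣⇒∃[x∈q∖p] ∣p∣<∣q∣ = p⊈q⇒∃[x∈p∖q] (<⇒≱ ∣p∣<∣q∣ ∘ p⊆q⇒∣p∣≤∣q∣)

Admissible : Job n → Fin n → Subset n → Set
Admissible j t X = release j ≤ᶠ t × t ≤ᶠ deadline j × t ∉ X

independent-⊆ : ∀ (J : List (Job n)) → Y ⊆ X → Independent J X → Independent J Y
independent-⊆ J Y⊆X (σ , σ-inj , σ-ok) = σ , σ-inj , λ i →
  let r≤σ , σ≤d , σ∉X = σ-ok i in r≤σ , σ≤d , σ∉X ∘ Y⊆X

independent-[] : ∀ (X : Subset n) → Independent [] X
independent-[] X = (λ ()) , (λ { {()} }) , λ ()

independent-∷⁻ : ∀ (j : Job n) J → Independent (j ∷ J) X →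
  ∃ λ t → Admissible j t X × Independent J (⁅ t ⁆ ∪ X)
independent-∷⁻ {X = X} j J (σ , σ-inj , σ-ok) =
  σ zero , σ-ok zero , σ ∘ suc , suc-injective ∘ σ-inj , σ∘suc-ok
  where
  σ∘suc-ok : ∀ i → Admissible (lookup J i) (σ (suc i)) (⁅ σ zero ⁆ ∪ X)
  σ∘suc-ok i = let r≤σ , σ≤d , σ∉X = σ-ok (suc i) in
    r≤σ , σ≤d , x∉p∪q⁺ (x≢y⇒x∉⁅y⁆ (λ σi≡σ0 → 0≢1+n (sym (σ-inj σi≡σ0)))) σ∉X

independent-∷⁺ : ∀ (j : Job n) J {t} → Admissible j t X → Independent J (⁅ t ⁆ ∪ X) →
  Independent (j ∷ J) X
independent-∷⁺ {n} {X} j J {t} t-ok (τ , τ-inj , τ-ok) = σ , σ-inj , σ-ok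
  where
  τ≢t : ∀ i → τ i ≢ t
  τ≢t i = x∉⁅y⁆⇒x≢y (proj₁ (x∉p∪q⁻ ⁅ t ⁆ X (proj₂ (proj₂ (τ-ok i)))))
  σ : Fin (suc (length J)) → Fin n
  σ zero    = t
  σ (suc i) = τ i
  σ-inj : Injective _≡_ _≡_ σ
  σ-inj {zero}  {zero}  _ = refl
  σ-inj {zero}  {suc b} t≡τb = contradiction (sym t≡τb) (τ≢t b)
  σ-inj {suc a} {zero}  τa≡t = contradiction τa≡t (τ≢t a)
  σ-inj {suc a} {suc b} τa≡τb = cong suc (τ-inj τa≡τb)
  σ-ok : ∀ i → Admissible (lookup (j ∷ J) i) (σ i) X
  σ-ok zero    = t-ok
  σ-ok (suc i) = let r≤τ , τ≤d , τ∉tX = τ-ok i in r≤τ , τ≤d , proj₂ (x∉p∪q⁻ ⁅ t ⁆ X τ∉tX)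

independent-∷⁺-∪ : ∀ (j : Job n) J {t} → Admissible j t (p ∪ X) →
  Independent J (p ∪ ⁅ t ⁆ ∪ X) → Independent (j ∷ J) (p ∪ X)
independent-∷⁺-∪ {p = p} {X = X} j J {t} t-ok ind =
  independent-∷⁺ j J t-ok (independent-⊆ J (⊆-reflexive (p∪q∪r≡q∪p∪r ⁅ t ⁆ p X)) ind)

independent-augment : ∀ (J : List (Job n)) → Independent J X → Independent J Y →
  ∣ X ∣ < ∣ Y ∣ → ∃ λ y → y ∈ Y × y ∉ X × Independent J (⁅ y ⁆ ∪ X)
independent-augment [] _ _ ∣X∣<∣Y∣ =
  let y , y∈Y , y∉X = ∣p∣<∣q∣⇒∃[x∈q∖p] ∣X∣<∣Y∣ in y , y∈Y , y∉X , independent-[] _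
independent-augment {X = X} {Y = Y} (j ∷ J) indX indY ∣X∣<∣Y∣
  with a , (r≤a , a≤d , a∉X) , ind[aX] ← independent-∷⁻ j J indX
  with b , (r≤b , b≤d , b∉Y) , ind[bY] ← independent-∷⁻ j J indY
  with y , y∈bY , y∉aX , ind[yaX] ← independent-augment J ind[aX] ind[bY]
                                       (∣⁅x⁆∪p∣<∣⁅y⁆∪q∣ a∉X b∉Y ∣X∣<∣Y∣)
  with y∉⁅a⁆ , y∉X ← x∉p∪q⁻ ⁅ a ⁆ X y∉aX
  with x∈p∪q⁻ ⁅ b ⁆ Y y∈bY
... | inj₂ y∈Y =
  y , y∈Y , y∉X , independent-∷⁺-∪ j J (r≤a , a≤d , x∉p∪q⁺ (x∉⁅y⁆⇒y∉⁅x⁆ y∉⁅a⁆) a∉X) ind[yaX]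
... | inj₁ y∈⁅b⁆ with refl ← x∈⁅y⁆⇒x≡y b y∈⁅b⁆
  with z , z∈bY , z∉bX , ind[zbX] ← independent-augment J
                                       (independent-⊆ J (∪-monoʳ-⊆ (q⊆p∪q ⁅ a ⁆ X)) ind[yaX]) ind[bY]
                                       (∣⁅x⁆∪p∣<∣⁅y⁆∪q∣ y∉X b∉Y ∣X∣<∣Y∣)
  with z∉⁅b⁆ , z∉X ← x∉p∪q⁻ ⁅ b ⁆ X z∉bX
  = z , x∈p∪q∧x∉p⇒x∈q ⁅ b ⁆ Y z∈bY z∉⁅b⁆ , z∉X ,
    independent-∷⁺-∪ j J (r≤b , b≤d , x∉p∪q⁺ (x∉⁅y⁆⇒y∉⁅x⁆ z∉⁅b⁆) y∉X) ind[zbX]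

rigid : List (Fin n) → List (Job n)
rigid = map (λ x → x , x)

independent-++⁻ʳ : ∀ (J : List (Job n)) {K} → Independent (J ++ K) X → Independent K X
independent-++⁻ʳ []      ind = ind
independent-++⁻ʳ (j ∷ J) {K} ind =
  let t , _ , ind′ = independent-∷⁻ j (J ++ K) ind in
  independent-⊆ K (q⊆p∪q ⁅ t ⁆ _) (independent-++⁻ʳ J ind′)

independent-rigid⇒∉ : ∀ (L : List (Fin n)) → Independent (rigid L) X → x ∈ₗ L → x ∉ X
independent-rigid⇒∉ {X = X} (y ∷ L) ind x∈yL
  with t , (y≤t , t≤y , t∉X) , ind′ ← independent-∷⁻ (y , y) (rigid L) ind
  with refl ← ≤ᶠ-antisym y≤t t≤y
  with x∈yL
... | here refl  = t∉X
... | there x∈L = proj₂ (x∉p∪q⁻ ⁅ t ⁆ X (independent-rigid⇒∉ L ind′ x∈L))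

∉⇒independent-rigid : ∀ (L : List (Fin n)) → Unique L → (∀ {x} → x ∈ₗ L → x ∉ X) →
  Independent (rigid L) X
∉⇒independent-rigid []      _             _     = independent-[] _
∉⇒independent-rigid (y ∷ L) (y∉L ∷ uniq) L∉X =
  independent-∷⁺ (y , y) (rigid L) (≤ᶠ-refl , ≤ᶠ-refl , L∉X (here refl))
    (∉⇒independent-rigid L uniq λ x∈L →
      x∉p∪q⁺ (x≢y⇒x∉⁅y⁆ (lookupᴬ y∉L x∈L ∘ sym)) (L∉X (there x∈L)))

x∈p⇒x∈elements : x ∈ p → x ∈ₗ elements p
x∈p⇒x∈elements {x = x} {p = p} x∈p = ∈-filter⁺ (_∈? p) (∈-allFin x) x∈p

x∈elements⇒x∈p : x ∈ₗ elements p → x ∈ p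
x∈elements⇒x∈p {n} {p = p} x∈elems = proj₂ (∈-filter⁻ (_∈? p) {xs = allFin n} x∈elems)

elements-unique : ∀ (p : Subset n) → Unique (elements p)
elements-unique {n} p = filter⁺ (_∈? p) (allFin⁺ n)

independent-rigidJobs⇒Disjoint : ∀ (F : Subset n) → Independent (rigidJobs F) X → Disjoint F X
independent-rigidJobs⇒Disjoint F ind = independent-rigid⇒∉ (elements F) ind ∘ x∈p⇒x∈elements

Disjoint⇒independent-rigidJobs : ∀ (F : Subset n) → Disjoint F X → Independent (rigidJobs F) X
Disjoint⇒independent-rigidJobs F F#X =
  ∉⇒independent-rigid (elements F) (elements-unique F) (F#X ∘ x∈elements⇒x∈p)

independent-++rigidJobs⇒Disjoint : ∀ J (F : Subset n) → Independent (J ++ rigidJobs F) X →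
  Disjoint F X
independent-++rigidJobs⇒Disjoint J F = independent-rigidJobs⇒Disjoint F ∘ independent-++⁻ʳ J

independent-++rigidJobs⁻ : ∀ J (F : Subset n) → Independent (J ++ rigidJobs F) X →
  Independent J (F ∪ X)
independent-++rigidJobs⁻ []      F _   = independent-[] _
independent-++rigidJobs⁻ {X = X} (j ∷ J) F ind =
  let t , (r≤t , t≤d , t∉X) , ind′ = independent-∷⁻ j (J ++ rigidJobs F) ind
      t∉F = λ t∈F → independent-++rigidJobs⇒Disjoint J F ind′ t∈F (p⊆p∪q X (x∈⁅x⁆ t))
  in independent-∷⁺-∪ j J (r≤t , t≤d , x∉p∪q⁺ t∉F t∉X) (independent-++rigidJobs⁻ J F ind′)

independent-++rigidJobs⁺ : ∀ J (F : Subset n) → Disjoint F X → Independent J (F ∪ X) →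
  Independent (J ++ rigidJobs F) X
independent-++rigidJobs⁺ []      F F#X _   = Disjoint⇒independent-rigidJobs F F#X
independent-++rigidJobs⁺ {X = X} (j ∷ J) F F#X ind =
  let t , (r≤t , t≤d , t∉FX) , ind′ = independent-∷⁻ j J ind
      t∉F , t∉X = x∉p∪q⁻ F X t∉FX
  in independent-∷⁺ j _ (r≤t , t≤d , t∉X)
       (independent-++rigidJobs⁺ J F (Disjoint-⁅x⁆∪ t∉F F#X)
         (independent-⊆ J (⊆-reflexive (p∪q∪r≡q∪p∪r F ⁅ t ⁆ X)) ind′))

MaxIndepIn⇒unextendable : ∀ (J : List (Job n)) {g} → MaxIndepIn J S X → g ∈ S → g ∉ X →
  ¬ Independent J (⁅ g ⁆ ∪ X)
MaxIndepIn⇒unextendable {X = X} J (X⊆S , _ , maximum) g∈S g∉X ind[gX] =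
  1+n≰n (subst (_≤ ∣ X ∣) (x∉p⇒∣⁅x⁆∪p∣≡1+∣p∣ g∉X)
                (maximum _ (∪-lub (x∈p⇒⁅x⁆⊆p g∈S) X⊆S) ind[gX]))

unextendable⇒MaxIndepIn : ∀ (J : List (Job n)) → X ⊆ S → Independent J X →
  (∀ {g} → g ∈ S → g ∉ X → ¬ Independent J (⁅ g ⁆ ∪ X)) → MaxIndepIn J S X
unextendable⇒MaxIndepIn J X⊆S indX unextendable =
  X⊆S , indX , λ G G⊆S indG → ≮⇒≥ λ ∣X∣<∣G∣ →
  let g , g∈G , g∉X , ind[gX] = independent-augment J indX indG ∣X∣<∣G∣
  in unextendable (G⊆S g∈G) g∉X ind[gX]

lemma6 : ∀ {n : ℕ} (J : List (Job n)) → Feasible J →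
    (S F : Subset n) → MaxIndepIn J S F →
    (H B : Subset n) → MaxIndepIn (J ++ rigidJobs F) H B →
    Independent J (F ∪ B) × MaxIndepIn J (S ∪ H) (F ∪ B)
lemma6 J _ S F maxF@(F⊆S , _ , _) H B maxB@(B⊆H , indB , _) =
  ind[FB] , unextendable⇒MaxIndepIn J (∪-mono-⊆ F⊆S B⊆H) ind[FB] unextendable
  where
  ind[FB] : Independent J (F ∪ B)
  ind[FB] = independent-++rigidJobs⁻ J F indB
  unextendable : ∀ {g} → g ∈ S ∪ H → g ∉ F ∪ B → ¬ Independent J (⁅ g ⁆ ∪ F ∪ B)
  unextendable {g} g∈S∪H g∉FB ind[gFB] with g∉F , g∉B ← x∉p∪q⁻ F B g∉FB | x∈p∪q⁻ S H g∈S∪H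
  ... | inj₁ g∈S = MaxIndepIn⇒unextendable J maxF g∈S g∉F
    (independent-⊆ J (∪-monoʳ-⊆ (p⊆p∪q B)) ind[gFB])
  ... | inj₂ g∈H = MaxIndepIn⇒unextendable (J ++ rigidJobs F) maxB g∈H g∉B
    (independent-++rigidJobs⁺ J F (Disjoint-⁅x⁆∪ g∉F (independent-++rigidJobs⇒Disjoint J F indB))
      (independent-⊆ J (⊆-reflexive (p∪q∪r≡q∪p∪r F ⁅ g ⁆ B)) ind[gFB]))
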